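{- Let $m,n\geq 0$. The Galois graph of $\mathbf{W}(m,n)$ is the directed graph on the set of join-irreducible elements of $\mathbf{W}(m,n)$ in which, for distinct join-irreducibles $\mathfrak{j}\ne\mathfrak{j}'$, there is an arrow $\mathfrak{j}\to\mathfrak{j}'$ if and only if either $\mathfrak{j}=\mathfrak{a}^{(s,t)}$, $\mathfrak{j}'=\mathfrak{a}^{(s',t')}$ with $s\ge s'$ and $t\ge t'$, or $\mathfrak{j}=\mathfrak{b}^{(s)}$, $\mathfrak{j}'=\mathfrak{a}^{(s',t')}$ with $s=s'$.
   Context: An $(m,n)$-word is a word $\mathfrak{w}=w_1w_2\cdots w_n$ of length $n$ over the alphabet $\{0,1,\dots,m+1\}$ such that (MN1) $w_1\neq m+1$, and (MN2) for every $s$ with $1\le s\le m$ and every index $i$, if $w_i=s$ then $w_j\ge s$ for all $j<i$. $\mathbf{W}(m,n)$ is the set of $(m,n)$-words ordered componentwise; it is an extremal, interval-constructable lattice whose join is componentwise maximum. Its join-irreducible elements (elements covering exactly one element) are exactly the words $\mathfrak{a}^{(s,t)}$ ($1\le s\le n$, $1\le t\le m$), having letter $t$ in positions $1,\dots,s$ and $0$ elsewhere, and $\mathfrak{b}^{(s)}$ ($2\le s\le n$), having letter $m+1$ in position $s$ and $0$ elsewhere. For a join-irreducible $j$ let $j_*$ denote the unique element it covers. For an extremal, interval-constructable lattice $\mathbf{P}$, its Galois graph is the directed graph on the join-irreducible elements of $\mathbf{P}$ with an arrow $j\to j'$ if and only if $j\ne j'$ and $j'\le j'_*\vee j$. -}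

module Defs where

open import Data.Nat using (ℕ; zero; suc; _≤_; _<_; _⊔_; _∸_)
open import Data.Fin using (Fin; toℕ)
open import Data.Vec using (Vec; lookup; tabulate; zipWith)
open import Data.Product using (Σ; _×_; proj₁)
open import Data.Bool using (if_then_else_)
open import Relation.Nullary using (¬_)
open import Relation.Nullary.Decidable using (⌊_⌋)
open import Relation.Binary.PropositionalEquality using (_≡_; _≢_)
import Data.Nat as N

-- Words of length n are vectors of naturals; position i (0-based Fin) is
-- position toℕ i + 1 in the paper's 1-based indexing.
Word : ℕ → Set
Word n = Vec ℕ n

record IsWord (m n : ℕ) (w : Word n) : Set where
  field
    alphabet : ∀ (i : Fin n) → lookup w i ≤ suc m
    mn1      : ∀ (i : Fin n) → toℕ i ≡ 0 → lookup w i ≢ suc m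
    mn2      : ∀ (i j : Fin n) → 1 ≤ lookup w i → lookup w i ≤ m →
               toℕ j < toℕ i → lookup w i ≤ lookup w j

_≤w_ : ∀ {n} → Word n → Word n → Set
x ≤w y = ∀ i → lookup x i ≤ lookup y i

_<w_ : ∀ {n} → Word n → Word n → Set
x <w y = x ≤w y × x ≢ y

_∨w_ : ∀ {n} → Word n → Word n → Word n
x ∨w y = zipWith _⊔_ x y

Covers : (m n : ℕ) → Word n → Word n → Set
Covers m n x y = IsWord m n x × IsWord m n y × x <w y ×
  (∀ z → IsWord m n z → x <w z → ¬ (z <w y))

JoinIrr : (m n : ℕ) → Word n → Set
JoinIrr m n j = IsWord m n j × Σ (Word n) λ c → Covers m n c j ×
  (∀ c' → Covers m n c' j → c' ≡ c)

lower : ∀ {m n j} → JoinIrr m n j → Word n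
lower ji = proj₁ (Data.Product.proj₂ ji)

Arrow : (m n : ℕ) (j j' : Word n) → JoinIrr m n j → JoinIrr m n j' → Set
Arrow m n j j' ji ji' = j ≢ j' × j' ≤w (lower ji' ∨w j)

𝔞 : (n s t : ℕ) → Word n
𝔞 n s t = tabulate λ i → if ⌊ toℕ i N.<? s ⌋ then t else 0

𝔟 : (m n s : ℕ) → Word n
𝔟 m n s = tabulate λ i → if ⌊ toℕ i N.≟ (s ∸ 1) ⌋ then suc m else 0

-- Call a position p of a word w lowerable when the letter there is positive and, if it
-- lies in {1,…,m}, it exceeds every later letter in {1,…,m}.  Decreasing the letter at a
-- lowerable position as little as possible yields a word covered by w.  A join-irreducible
-- j covers only one word, so it has a single lowerable position p and j_* differs from j
-- only there, being smaller.  Hence j' ≤ j'_* ∨ j holds iff j'_p ≤ j_p.  The last nonzero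
-- position of j is lowerable, which forces j to be some a^(s,t) or b^(s); reading off the
-- letters at the lowerable position then gives the two kinds of arrows.
module Submission where

open import Defs
open import Data.Nat using (ℕ; zero; suc; _≤_; _<_; _⊔_; _⊓_; _∸_; z≤n; s≤s; z<s)
open import Data.Nat.Properties
open import Data.Fin using (Fin; toℕ; fromℕ<) renaming (zero to fzero; suc to fsuc)
open import Data.Fin.Properties using (toℕ-fromℕ<; toℕ-injective; toℕ<n; ¬∀⟶∃¬; any?)
  renaming (_≟_ to _≟ᶠ_)
open import Data.Vec using (lookup; _[_]≔_)
open import Data.Vec.Properties using (lookup∘tabulate; lookup-zipWith; lookup∘update; lookup∘update′)
open import Data.Vec.Relation.Binary.Pointwise.Extensional using (ext; Pointwise-≡⇒≡)
open import Data.Product using (Σ; _×_; ∃; _,_; proj₁; proj₂; map₂)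
open import Data.Sum using (_⊎_; inj₁; inj₂)
open import Data.Bool using (if_then_else_)
open import Data.Empty using (⊥; ⊥-elim)
open import Function using (_∘_)
open import Function.Bundles using (_⇔_; mk⇔)
open import Relation.Nullary using (¬_; Dec; yes; no)
open import Relation.Nullary.Decidable using (⌊_⌋; _×-dec_)
open import Relation.Unary using (Decidable)
open import Relation.Binary.PropositionalEquality using (_≡_; _≢_; refl; sym; trans; cong; subst; subst₂)

EqualExcept : ∀ {n} → Fin n → Word n → Word n → Set
EqualExcept p x y = ∀ i → i ≢ p → lookup x i ≡ lookup y i

EqualExcept⇒≡ : ∀ {n} {p : Fin n} {x y : Word n} →
  EqualExcept p x y → lookup x p ≡ lookup y p → x ≡ y
EqualExcept⇒≡ {p = p} {x} {y} x≈y xp≡yp = Pointwise-≡⇒≡ (ext pointwise)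
  where
  pointwise : ∀ i → lookup x i ≡ lookup y i
  pointwise i with i ≟ᶠ p
  ... | yes refl = xp≡yp
  ... | no i≢p = x≈y i i≢p

last-satisfying : ∀ {n} {P : Fin n → Set} → Decidable P → ∃ P →
  ∃ λ i → P i × (∀ q → toℕ i < toℕ q → ¬ P q)
last-satisfying {suc n} {P} P? (i , Pi) with any? (P? ∘ fsuc)
... | no none = fzero , at-zero i Pi , λ { (fsuc q) _ → none ∘ (q ,_) }
  where
  at-zero : ∀ i → P i → P fzero
  at-zero fzero P0 = P0
  at-zero (fsuc i) Pi = ⊥-elim (none (i , Pi))
... | yes witness with last-satisfying (P? ∘ fsuc) witness
...   | k , Pk , none-after = fsuc k , Pk , λ { (fsuc q) (s≤s k<q) → none-after q k<q }

suc-toℕ-onto : ∀ {n s} → 1 ≤ s → s ≤ n → Σ (Fin n) λ p → suc (toℕ p) ≡ s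
suc-toℕ-onto (s≤s z≤n) k<n = fromℕ< k<n , cong suc (toℕ-fromℕ< k<n)

if-⌊⌋-yes : ∀ {P : Set} (P? : Dec P) {a b : ℕ} → P → (if ⌊ P? ⌋ then a else b) ≡ a
if-⌊⌋-yes (yes _) _ = refl
if-⌊⌋-yes (no ¬p) p = ⊥-elim (¬p p)

if-⌊⌋-no : ∀ {P : Set} (P? : Dec P) {a b : ℕ} → ¬ P → (if ⌊ P? ⌋ then a else b) ≡ b
if-⌊⌋-no (yes p) ¬p = ⊥-elim (¬p p)
if-⌊⌋-no (no _) _ = refl

lookup-𝔞-< : ∀ {n s t} (i : Fin n) → toℕ i < s → lookup (𝔞 n s t) i ≡ t
lookup-𝔞-< {s = s} i i<s = trans (lookup∘tabulate _ i) (if-⌊⌋-yes (toℕ i <? s) i<s)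

lookup-𝔞-≮ : ∀ {n s t} (i : Fin n) → ¬ toℕ i < s → lookup (𝔞 n s t) i ≡ 0
lookup-𝔞-≮ {s = s} i i≮s = trans (lookup∘tabulate _ i) (if-⌊⌋-no (toℕ i <? s) i≮s)

lookup-𝔞-last : ∀ {n t} (p : Fin n) → lookup (𝔞 n (suc (toℕ p)) t) p ≡ t
lookup-𝔞-last p = lookup-𝔞-< p ≤-refl

lookup-𝔞-≤ : ∀ {n s t} (i : Fin n) → lookup (𝔞 n s t) i ≤ t
lookup-𝔞-≤ {s = s} i with toℕ i <? s
... | yes i<s = ≤-reflexive (lookup-𝔞-< i i<s)
... | no i≮s = ≤-trans (≤-reflexive (lookup-𝔞-≮ i i≮s)) z≤n

𝔞-support : ∀ {n s t} (i : Fin n) → 1 ≤ lookup (𝔞 n s t) i → toℕ i < s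
𝔞-support {s = s} i 1≤ai with toℕ i <? s
... | yes i<s = i<s
... | no i≮s = ⊥-elim (n≮0 (subst (1 ≤_) (lookup-𝔞-≮ i i≮s) 1≤ai))

lookup-𝔟-at : ∀ {m n} (p : Fin n) → lookup (𝔟 m n (suc (toℕ p))) p ≡ suc m
lookup-𝔟-at p = trans (lookup∘tabulate _ p) (if-⌊⌋-yes (toℕ p ≟ toℕ p) refl)

lookup-𝔟-≢ : ∀ {m n s} (i : Fin n) → toℕ i ≢ s ∸ 1 → lookup (𝔟 m n s) i ≡ 0
lookup-𝔟-≢ {s = s} i i≢s = trans (lookup∘tabulate _ i) (if-⌊⌋-no (toℕ i ≟ (s ∸ 1)) i≢s)

𝔟-support : ∀ {m n s} (i : Fin n) → 1 ≤ lookup (𝔟 m n s) i → toℕ i ≡ s ∸ 1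
𝔟-support {s = s} i 1≤bi with toℕ i ≟ (s ∸ 1)
... | yes i≡s = i≡s
... | no i≢s = ⊥-elim (n≮0 (subst (1 ≤_) (lookup-𝔟-≢ {s = s} i i≢s) 1≤bi))

lookup⇒≡𝔞 : ∀ {n s t} {w : Word n} → (∀ i → toℕ i < s → lookup w i ≡ t) →
  (∀ i → s ≤ toℕ i → lookup w i ≡ 0) → w ≡ 𝔞 n s t
lookup⇒≡𝔞 {n} {s} {t} {w} inside outside = Pointwise-≡⇒≡ (ext pointwise)
  where
  pointwise : ∀ i → lookup w i ≡ lookup (𝔞 n s t) i
  pointwise i with toℕ i <? s
  ... | yes i<s = trans (inside i i<s) (sym (lookup-𝔞-< i i<s))
  ... | no i≮s = trans (outside i (≮⇒≥ i≮s)) (sym (lookup-𝔞-≮ i i≮s))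

lookup⇒≡𝔟 : ∀ {m n} {w : Word n} {p : Fin n} → lookup w p ≡ suc m →
  (∀ i → i ≢ p → lookup w i ≡ 0) → w ≡ 𝔟 m n (suc (toℕ p))
lookup⇒≡𝔟 {m} {n} {w} {p} wp≡top outside = Pointwise-≡⇒≡ (ext pointwise)
  where
  pointwise : ∀ i → lookup w i ≡ lookup (𝔟 m n (suc (toℕ p))) i
  pointwise i with i ≟ᶠ p
  ... | yes refl = trans wp≡top (sym (lookup-𝔟-at p))
  ... | no i≢p = trans (outside i i≢p) (sym (lookup-𝔟-≢ {s = suc (toℕ p)} i (i≢p ∘ toℕ-injective)))

update-isWord : ∀ {m n} {w : Word n} {p : Fin n} {v : ℕ} → IsWord m n w → v ≤ m →
  (∀ j → toℕ j < toℕ p → v ≤ lookup w j) →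
  (∀ i → 1 ≤ lookup w i → lookup w i ≤ m → toℕ p < toℕ i → lookup w i ≤ v) →
  IsWord m n (w [ p ]≔ v)
update-isWord {m} {n} {w} {p} {v} vw v≤m v≤before after≤v =
  record { alphabet = alphabet ; mn1 = mn1 ; mn2 = mn2 }
  where
  module W = IsWord vw
  alphabet : ∀ i → lookup (w [ p ]≔ v) i ≤ suc m
  alphabet i with i ≟ᶠ p
  ... | yes refl rewrite lookup∘update i w v = m≤n⇒m≤1+n v≤m
  ... | no i≢p rewrite lookup∘update′ i≢p w v = W.alphabet i
  mn1 : ∀ i → toℕ i ≡ 0 → lookup (w [ p ]≔ v) i ≢ suc m
  mn1 i i≡0 with i ≟ᶠ p
  ... | yes refl rewrite lookup∘update i w v = <⇒≢ (s≤s v≤m)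
  ... | no i≢p rewrite lookup∘update′ i≢p w v = W.mn1 i i≡0
  mn2 : ∀ i j → 1 ≤ lookup (w [ p ]≔ v) i → lookup (w [ p ]≔ v) i ≤ m → toℕ j < toℕ i →
        lookup (w [ p ]≔ v) i ≤ lookup (w [ p ]≔ v) j
  mn2 i j 1≤ci ci≤m j<i with i ≟ᶠ p | j ≟ᶠ p
  ... | yes refl | yes refl = ⊥-elim (<-irrefl refl j<i)
  ... | yes refl | no j≢p rewrite lookup∘update i w v | lookup∘update′ j≢p w v = v≤before j j<i
  ... | no i≢p | yes refl rewrite lookup∘update j w v | lookup∘update′ i≢p w v = after≤v i 1≤ci ci≤m j<i
  ... | no i≢p | no j≢p rewrite lookup∘update′ i≢p w v | lookup∘update′ j≢p w v =
    W.mn2 i j 1≤ci ci≤m j<i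

update-covered : ∀ {m n} {w : Word n} {p : Fin n} {v : ℕ} →
  IsWord m n w → IsWord m n (w [ p ]≔ v) → v < lookup w p →
  (∀ z → IsWord m n z → EqualExcept p z w → v < lookup z p → lookup z p < lookup w p → ⊥) →
  Covers m n (w [ p ]≔ v) w
update-covered {m} {n} {w} {p} {v} vw vc v<wp no-gap = vc , vw , (c≤w , c≢w) , nothing-between
  where
  c = w [ p ]≔ v
  c≈w : EqualExcept p c w
  c≈w i i≢p = lookup∘update′ i≢p w v
  cp≡v : lookup c p ≡ v
  cp≡v = lookup∘update p w v
  c≤w : c ≤w w
  c≤w i with i ≟ᶠ p
  ... | yes refl = subst (_≤ lookup w i) (sym cp≡v) (<⇒≤ v<wp)
  ... | no i≢p = ≤-reflexive (c≈w i i≢p)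
  c≢w : c ≢ w
  c≢w c≡w = <⇒≢ v<wp (trans (sym cp≡v) (cong (λ x → lookup x p) c≡w))
  squeezed : ∀ z → c ≤w z → z ≤w w → EqualExcept p z w
  squeezed z c≤z z≤w i i≢p = ≤-antisym (z≤w i) (≤-trans (≤-reflexive (sym (c≈w i i≢p))) (c≤z i))
  nothing-between : ∀ z → IsWord m n z → c <w z → ¬ (z <w w)
  nothing-between z vz (c≤z , c≢z) (z≤w , z≢w)
    with m≤n⇒m<n∨m≡n (c≤z p) | m≤n⇒m<n∨m≡n (z≤w p)
  ... | inj₂ cp≡zp | _ =
    c≢z (EqualExcept⇒≡ (λ i i≢p → trans (c≈w i i≢p) (sym (squeezed z c≤z z≤w i i≢p))) cp≡zp)
  ... | _ | inj₂ zp≡wp = z≢w (EqualExcept⇒≡ (squeezed z c≤z z≤w) zp≡wp)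
  ... | inj₁ cp<zp | inj₁ zp<wp =
    no-gap z vz (squeezed z c≤z z≤w) (subst (_< lookup z p) cp≡v cp<zp) zp<wp

record Lowerable (m : ℕ) {n : ℕ} (w : Word n) (p : Fin n) : Set where
  field
    positive  : 1 ≤ lookup w p
    dominates : lookup w p ≤ m → ∀ q → toℕ p < toℕ q →
                1 ≤ lookup w q → lookup w q ≤ m → lookup w q < lookup w p

lower-middle-letter : ∀ {m n} {w : Word n} {p : Fin n} → IsWord m n w → Lowerable m w p →
  lookup w p ≤ m → Covers m n (w [ p ]≔ (lookup w p ∸ 1)) w
lower-middle-letter {m} {n} {w} {p} vw lw wp≤m = update-covered vw valid pred<wp no-gap
  where
  open Lowerable lw
  pred<wp : lookup w p ∸ 1 < lookup w p
  pred<wp = ∸-monoʳ-< z<s positive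
  valid : IsWord m n (w [ p ]≔ (lookup w p ∸ 1))
  valid = update-isWord vw (≤-trans pred[n]≤n wp≤m)
    (λ j j<p → ≤-trans pred[n]≤n (IsWord.mn2 vw p j positive wp≤m j<p))
    (λ i 1≤wi wi≤m p<i → <⇒≤pred (dominates wp≤m i p<i 1≤wi wi≤m))
  no-gap : ∀ z → IsWord m n z → EqualExcept p z w →
           lookup w p ∸ 1 < lookup z p → lookup z p < lookup w p → ⊥
  no-gap z _ _ pred<zp zp<wp = <⇒≱ pred<zp (<⇒≤pred zp<wp)

prefixMin : ∀ {n} → ℕ → (Fin n → ℕ) → ℕ → ℕ
prefixMin {zero} m f k = m
prefixMin {suc n} m f zero = m
prefixMin {suc n} m f (suc k) = f fzero ⊓ prefixMin m (f ∘ fsuc) k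

prefixMin≤bound : ∀ {n} m f k → prefixMin {n} m f k ≤ m
prefixMin≤bound {zero} m f k = ≤-refl
prefixMin≤bound {suc n} m f zero = ≤-refl
prefixMin≤bound {suc n} m f (suc k) = ≤-trans (m⊓n≤n _ _) (prefixMin≤bound m (f ∘ fsuc) k)

prefixMin≤ : ∀ {n} m f k (r : Fin n) → toℕ r < k → prefixMin m f k ≤ f r
prefixMin≤ {suc n} m f (suc k) fzero _ = m⊓n≤m _ _
prefixMin≤ {suc n} m f (suc k) (fsuc r) (s≤s r<k) =
  ≤-trans (m⊓n≤n _ _) (prefixMin≤ m (f ∘ fsuc) k r r<k)

prefixMin-greatest : ∀ {n} m f k v → v ≤ m → (∀ (r : Fin n) → toℕ r < k → v ≤ f r) →
  v ≤ prefixMin m f k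
prefixMin-greatest {zero} m f k v v≤m _ = v≤m
prefixMin-greatest {suc n} m f zero v v≤m _ = v≤m
prefixMin-greatest {suc n} m f (suc k) v v≤m v≤f = ⊓-glb (v≤f fzero z<s)
  (prefixMin-greatest m (f ∘ fsuc) k v v≤m (λ r r<k → v≤f (fsuc r) (s≤s r<k)))

-- By (MN2) the letter at p of any word agreeing with w off p can be at most the minimum
-- of m and the earlier letters, and that value is attained.
lower-top-letter : ∀ {m n} {w : Word n} {p : Fin n} → IsWord m n w → lookup w p ≡ suc m →
  Covers m n (w [ p ]≔ prefixMin m (lookup w) (toℕ p)) w
lower-top-letter {m} {n} {w} {p} vw wp≡top = update-covered vw valid v<wp no-gap
  where
  v = prefixMin m (lookup w) (toℕ p)
  v<wp : v < lookup w p
  v<wp = subst (v <_) (sym wp≡top) (s≤s (prefixMin≤bound m (lookup w) (toℕ p)))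
  valid : IsWord m n (w [ p ]≔ v)
  valid = update-isWord vw (prefixMin≤bound m (lookup w) (toℕ p)) (prefixMin≤ m (lookup w) (toℕ p))
    (λ i 1≤wi wi≤m p<i → prefixMin-greatest m (lookup w) (toℕ p) _ wi≤m
       (λ r r<p → IsWord.mn2 vw i r 1≤wi wi≤m (<-trans r<p p<i)))
  no-gap : ∀ z → IsWord m n z → EqualExcept p z w → v < lookup z p → lookup z p < lookup w p → ⊥
  no-gap z vz z≈w v<zp zp<wp = <⇒≱ v<zp (prefixMin-greatest m (lookup w) (toℕ p) _ zp≤m zp≤before)
    where
    zp≤m : lookup z p ≤ m
    zp≤m = ≤-pred (subst (lookup z p <_) wp≡top zp<wp)
    zp≤before : ∀ r → toℕ r < toℕ p → lookup z p ≤ lookup w r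
    zp≤before r r<p = subst (lookup z p ≤_) (z≈w r (λ r≡p → <-irrefl (cong toℕ r≡p) r<p))
      (IsWord.mn2 vz p r (≤-trans (s≤s z≤n) v<zp) zp≤m r<p)

lowerable⇒covers : ∀ {m n} {w : Word n} {p : Fin n} → IsWord m n w → Lowerable m w p →
  Σ ℕ λ v → Covers m n (w [ p ]≔ v) w
lowerable⇒covers {m} {w = w} {p} vw lw with lookup w p ≤? m
... | yes wp≤m = _ , lower-middle-letter vw lw wp≤m
... | no wp≰m = _ , lower-top-letter vw (≤-antisym (IsWord.alphabet vw p) (≰⇒> wp≰m))

lower-at-lowerable : ∀ {m n j} {p : Fin n} (ji : JoinIrr m n j) → Lowerable m j p →
  EqualExcept p (lower ji) j × lookup (lower ji) p < lookup j p
lower-at-lowerable {j = j} {p} (vj , _ , _ , unique) lp with lowerable⇒covers vj lp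
... | v , cover@(_ , _ , (c≤j , c≢j) , _) with unique _ cover
... | refl = c≈j , ≤∧≢⇒< (c≤j p) (c≢j ∘ EqualExcept⇒≡ c≈j)
  where
  c≈j : EqualExcept p (j [ p ]≔ v) j
  c≈j i i≢p = lookup∘update′ i≢p j v

lowerable-unique : ∀ {m n j} {p q : Fin n} → JoinIrr m n j →
  Lowerable m j p → Lowerable m j q → p ≡ q
lowerable-unique {p = p} {q} ji lp lq with p ≟ᶠ q
... | yes p≡q = p≡q
... | no p≢q =
  ⊥-elim (<-irrefl (proj₁ (lower-at-lowerable ji lq) p p≢q) (proj₂ (lower-at-lowerable ji lp)))

joinIrr-nonzero : ∀ {m n j} → JoinIrr m n j → ∃ λ i → 1 ≤ lookup j i
joinIrr-nonzero {n = n} {j} (_ , c , (_ , _ , (c≤j , c≢j) , _) , _) =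
  map₂ n≢0⇒n>0 (¬∀⟶∃¬ n (λ i → lookup j i ≡ 0) (λ i → lookup j i ≟ 0) (c≢j ∘ c≡j))
  where
  c≡j : (∀ i → lookup j i ≡ 0) → c ≡ j
  c≡j j≡0 = Pointwise-≡⇒≡ (ext λ i →
    trans (n≤0⇒n≡0 (subst (lookup c i ≤_) (j≡0 i) (c≤j i))) (sym (j≡0 i)))

last-nonzero-position : ∀ {m n j} → JoinIrr m n j →
  Σ (Fin n) λ L → Lowerable m j L × (∀ q → toℕ L < toℕ q → lookup j q ≡ 0)
last-nonzero-position {j = j} ji with last-satisfying (λ i → 1 ≤? lookup j i) (joinIrr-nonzero ji)
... | L , 1≤jL , none-after =
  L , record { positive = 1≤jL ; dominates = λ _ q L<q 1≤jq _ → ⊥-elim (none-after q L<q 1≤jq) }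
    , λ q L<q → n≤0⇒n≡0 (≮⇒≥ (none-after q L<q))

-- In each case the last position where a letter of some kind occurs is lowerable, so it
-- must be L.
top-letter-shape : ∀ {m n j} {L : Fin n} → JoinIrr m n j → Lowerable m j L →
  lookup j L ≡ suc m → j ≡ 𝔟 m n (suc (toℕ L))
top-letter-shape {m} {n} {j} {L} ji lowL jL≡top = lookup⇒≡𝔟 jL≡top zero-off-L
  where
  no-middle-letter : ∀ i → ¬ (1 ≤ lookup j i × lookup j i ≤ m)
  no-middle-letter i middle
    with last-satisfying (λ i → (1 ≤? lookup j i) ×-dec (lookup j i ≤? m)) (i , middle)
  ... | q , (1≤jq , jq≤m) , none-after
    with lowerable-unique ji (record { positive = 1≤jq
           ; dominates = λ _ r q<r 1≤jr jr≤m → ⊥-elim (none-after r q<r (1≤jr , jr≤m)) }) lowL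
  ... | refl = 1+n≰n (subst (_≤ m) jL≡top jq≤m)
  zero-off-L : ∀ i → i ≢ L → lookup j i ≡ 0
  zero-off-L i i≢L = n≤0⇒n≡0 (≮⇒≥ λ 1≤ji → i≢L (lowerable-unique ji
    (record { positive = 1≤ji ; dominates = λ ji≤m → ⊥-elim (no-middle-letter i (1≤ji , ji≤m)) })
    lowL))

middle-letter-shape : ∀ {m n j} {L : Fin n} → JoinIrr m n j → Lowerable m j L →
  lookup j L ≤ m → (∀ q → toℕ L < toℕ q → lookup j q ≡ 0) → j ≡ 𝔞 n (suc (toℕ L)) (lookup j L)
middle-letter-shape {m} {n} {j} {L} ji lowL jL≤m zero-after = lookup⇒≡𝔞 up-to-L zero-after
  where
  open Lowerable lowL
  no-larger-letter : ∀ i → ¬ lookup j L < lookup j i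
  no-larger-letter i jL<ji with last-satisfying (λ i → lookup j L <? lookup j i) (i , jL<ji)
  ... | q , jL<jq , none-after
    with lowerable-unique ji (record { positive = ≤-trans positive (<⇒≤ jL<jq)
           ; dominates = λ _ r q<r _ _ → ≤-<-trans (≮⇒≥ (none-after r q<r)) jL<jq }) lowL
  ... | refl = <-irrefl refl jL<jq
  up-to-L : ∀ i → toℕ i < suc (toℕ L) → lookup j i ≡ lookup j L
  up-to-L i i≤L with m≤n⇒m<n∨m≡n (≤-pred i≤L)
  ... | inj₁ i<L = ≤-antisym (≮⇒≥ (no-larger-letter i)) (IsWord.mn2 (proj₁ ji) L i positive jL≤m i<L)
  ... | inj₂ i≡L = cong (lookup j) (toℕ-injective i≡L)

-- The paper's s is suc (toℕ p): p is the (0-based) lowerable position.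
data Shape (m n : ℕ) : Word n → Set where
  𝔞-shape : (p : Fin n) (t : ℕ) → 1 ≤ t → t ≤ m → Shape m n (𝔞 n (suc (toℕ p)) t)
  𝔟-shape : (p : Fin n) → 1 ≤ toℕ p → Shape m n (𝔟 m n (suc (toℕ p)))

position : ∀ {m n j} → Shape m n j → Fin n
position (𝔞-shape p _ _ _) = p
position (𝔟-shape p _) = p

𝔞-lowerable : ∀ {m n t} (p : Fin n) → 1 ≤ t → Lowerable m (𝔞 n (suc (toℕ p)) t) p
𝔞-lowerable p 1≤t = record
  { positive = subst (1 ≤_) (sym (lookup-𝔞-last p)) 1≤t
  ; dominates = λ _ q p<q 1≤aq _ → ⊥-elim (<⇒≱ p<q (≤-pred (𝔞-support q 1≤aq)))
  }

shape-lowerable : ∀ {m n j} (sh : Shape m n j) → Lowerable m j (position sh)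
shape-lowerable (𝔞-shape p _ 1≤t _) = 𝔞-lowerable p 1≤t
shape-lowerable {m} (𝔟-shape p _) = record
  { positive = subst (1 ≤_) (sym (lookup-𝔟-at p)) (s≤s z≤n)
  ; dominates = λ bp≤m → ⊥-elim (1+n≰n (subst (_≤ m) (lookup-𝔟-at p) bp≤m))
  }

joinIrr-shape : ∀ {m n j} → JoinIrr m n j → Shape m n j
joinIrr-shape {m} {n} {j} ji with last-nonzero-position ji
... | L , lowL , zero-after with lookup j L ≤? m
...   | yes jL≤m = subst (Shape m n) (sym (middle-letter-shape ji lowL jL≤m zero-after))
                     (𝔞-shape L _ (Lowerable.positive lowL) jL≤m)
...   | no jL≰m = subst (Shape m n) (sym (top-letter-shape ji lowL jL≡top))
                    (𝔟-shape L (n≢0⇒n>0 λ L≡0 → IsWord.mn1 (proj₁ ji) L L≡0 jL≡top))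
  where
  jL≡top : lookup j L ≡ suc m
  jL≡top = ≤-antisym (IsWord.alphabet (proj₁ ji) L) (≰⇒> jL≰m)

m≤n⊔o∧n<m⇒m≤o : ∀ {m n o} → m ≤ n ⊔ o → n < m → m ≤ o
m≤n⊔o∧n<m⇒m≤o {m} {n} {o} m≤n⊔o n<m with ⊔-sel n o
... | inj₁ n⊔o≡n = ⊥-elim (<⇒≱ n<m (subst (m ≤_) n⊔o≡n m≤n⊔o))
... | inj₂ n⊔o≡o = subst (m ≤_) n⊔o≡o m≤n⊔o

arrow⇒dominates : ∀ {m n j j'} {p : Fin n} (ji : JoinIrr m n j) (ji' : JoinIrr m n j') →
  Lowerable m j' p → Arrow m n j j' ji ji' → lookup j' p ≤ lookup j p
arrow⇒dominates {j = j} {j'} {p} ji ji' lp (_ , j'≤c∨j) = m≤n⊔o∧n<m⇒m≤o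
  (subst (lookup j' p ≤_) (lookup-zipWith _⊔_ p (lower ji') j) (j'≤c∨j p))
  (proj₂ (lower-at-lowerable ji' lp))

dominates⇒arrow : ∀ {m n j j'} {p : Fin n} (ji : JoinIrr m n j) (ji' : JoinIrr m n j') →
  Lowerable m j' p → j ≢ j' → lookup j' p ≤ lookup j p → Arrow m n j j' ji ji'
dominates⇒arrow {j = j} {j'} {p} ji ji' lp j≢j' j'p≤jp = j≢j' , j'≤c∨j
  where
  c = lower ji'
  j'≤c∨j : j' ≤w (c ∨w j)
  j'≤c∨j i rewrite lookup-zipWith _⊔_ i c j with i ≟ᶠ p
  ... | yes refl = ≤-trans j'p≤jp (m≤n⊔m _ _)
  ... | no i≢p = ≤-trans (≤-reflexive (sym (proj₁ (lower-at-lowerable ji' lp) i i≢p))) (m≤m⊔n _ _)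

GaloisEdge : (m n : ℕ) → Word n → Word n → Set
GaloisEdge m n j j' =
  (Σ ℕ λ s → Σ ℕ λ t → Σ ℕ λ s' → Σ ℕ λ t' →
     (1 ≤ s × s ≤ n × 1 ≤ t × t ≤ m) × (1 ≤ s' × s' ≤ n × 1 ≤ t' × t' ≤ m) ×
     j ≡ 𝔞 n s t × j' ≡ 𝔞 n s' t' × s' ≤ s × t' ≤ t)
  ⊎ (Σ ℕ λ s → Σ ℕ λ s' → Σ ℕ λ t' →
     (2 ≤ s × s ≤ n) × (1 ≤ s' × s' ≤ n × 1 ≤ t' × t' ≤ m) ×
     j ≡ 𝔟 m n s × j' ≡ 𝔞 n s' t' × s ≡ s')

dominates-at-position⇒galoisEdge : ∀ {m n j j'} → Shape m n j → (sh' : Shape m n j') → j ≢ j' →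
  lookup j' (position sh') ≤ lookup j (position sh') → GaloisEdge m n j j'
dominates-at-position⇒galoisEdge {n = n} (𝔞-shape p t 1≤t t≤m) (𝔞-shape p' t' 1≤t' t'≤m) _ dom =
  inj₁ (_ , _ , _ , _ , (s≤s z≤n , toℕ<n p , 1≤t , t≤m) , (s≤s z≤n , toℕ<n p' , 1≤t' , t'≤m) ,
        refl , refl , p'<s , subst (t' ≤_) (lookup-𝔞-< p' p'<s) t'≤ap')
  where
  t'≤ap' : t' ≤ lookup (𝔞 n (suc (toℕ p)) t) p'
  t'≤ap' = ≤-trans (≤-reflexive (sym (lookup-𝔞-last p'))) dom
  p'<s : toℕ p' < suc (toℕ p)
  p'<s = 𝔞-support p' (≤-trans 1≤t' t'≤ap')
dominates-at-position⇒galoisEdge {m} {n} (𝔟-shape p 1≤p) (𝔞-shape p' t' 1≤t' t'≤m) _ dom =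
  inj₂ (_ , _ , _ , (s≤s 1≤p , toℕ<n p) , (s≤s z≤n , toℕ<n p' , 1≤t' , t'≤m) ,
        refl , refl , cong suc (sym (𝔟-support {s = suc (toℕ p)} p' (≤-trans 1≤t' t'≤bp'))))
  where
  t'≤bp' : t' ≤ lookup (𝔟 m n (suc (toℕ p))) p'
  t'≤bp' = ≤-trans (≤-reflexive (sym (lookup-𝔞-last p'))) dom
dominates-at-position⇒galoisEdge {m} {n} (𝔞-shape p t _ t≤m) (𝔟-shape p' _) _ dom =
  ⊥-elim (1+n≰n (≤-trans m+1≤ap' (≤-trans (lookup-𝔞-≤ p') t≤m)))
  where
  m+1≤ap' : suc m ≤ lookup (𝔞 n (suc (toℕ p)) t) p'
  m+1≤ap' = ≤-trans (≤-reflexive (sym (lookup-𝔟-at p'))) dom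
dominates-at-position⇒galoisEdge {m} {n} (𝔟-shape p _) (𝔟-shape p' _) j≢j' dom =
  ⊥-elim (j≢j' (cong (λ k → 𝔟 m n (suc k))
    (sym (𝔟-support {s = suc (toℕ p)} p' (≤-trans (s≤s z≤n) m+1≤bp')))))
  where
  m+1≤bp' : suc m ≤ lookup (𝔟 m n (suc (toℕ p))) p'
  m+1≤bp' = ≤-trans (≤-reflexive (sym (lookup-𝔟-at p'))) dom

arrow⇒galoisEdge : ∀ {m n j j'} (ji : JoinIrr m n j) (ji' : JoinIrr m n j') →
  Arrow m n j j' ji ji' → GaloisEdge m n j j'
arrow⇒galoisEdge ji ji' arrow@(j≢j' , _) =
  dominates-at-position⇒galoisEdge (joinIrr-shape ji) sh' j≢j'
    (arrow⇒dominates ji ji' (shape-lowerable sh') arrow)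
  where
  sh' = joinIrr-shape ji'

galoisEdge⇒arrow : ∀ {m n j j'} (ji : JoinIrr m n j) (ji' : JoinIrr m n j') → j ≢ j' →
  GaloisEdge m n j j' → Arrow m n j j' ji ji'
galoisEdge⇒arrow ji ji' j≢j'
  (inj₁ (_ , _ , _ , _ , _ , (1≤s' , s'≤n , 1≤t' , _) , refl , refl , s'≤s , t'≤t))
  with suc-toℕ-onto 1≤s' s'≤n
... | p' , refl = dominates⇒arrow ji ji' (𝔞-lowerable p' 1≤t') j≢j'
  (subst₂ _≤_ (sym (lookup-𝔞-last p')) (sym (lookup-𝔞-< p' s'≤s)) t'≤t)
galoisEdge⇒arrow {m} ji ji' j≢j'
  (inj₂ (_ , _ , _ , _ , (1≤s' , s'≤n , 1≤t' , t'≤m) , refl , refl , refl))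
  with suc-toℕ-onto 1≤s' s'≤n
... | p' , refl = dominates⇒arrow ji ji' (𝔞-lowerable p' 1≤t') j≢j'
  (subst₂ _≤_ (sym (lookup-𝔞-last p')) (sym (lookup-𝔟-at p')) (m≤n⇒m≤1+n t'≤m))

theorem5p13 : (m n : ℕ) (j j' : Word n) (ji : JoinIrr m n j) (ji' : JoinIrr m n j') →
    j ≢ j' →
    Arrow m n j j' ji ji' ⇔
      ((Σ ℕ λ s → Σ ℕ λ t → Σ ℕ λ s' → Σ ℕ λ t' →
          (1 ≤ s × s ≤ n × 1 ≤ t × t ≤ m) × (1 ≤ s' × s' ≤ n × 1 ≤ t' × t' ≤ m) ×
          j ≡ 𝔞 n s t × j' ≡ 𝔞 n s' t' × s' ≤ s × t' ≤ t)
       ⊎ (Σ ℕ λ s → Σ ℕ λ s' → Σ ℕ λ t' →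
          (2 ≤ s × s ≤ n) × (1 ≤ s' × s' ≤ n × 1 ≤ t' × t' ≤ m) ×
          j ≡ 𝔟 m n s × j' ≡ 𝔞 n s' t' × s ≡ s'))
theorem5p13 m n j j' ji ji' j≢j' = mk⇔ (arrow⇒galoisEdge ji ji') (galoisEdge⇒arrow ji ji' j≢j')
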